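{- Let $G$ be a directed graph with positive edge weights, $s\in V(G)$, $T$ a shortest-path tree of $G$ rooted at $s$, $z$ a centroid of $T$, $(T_1,T_2)$ the centroid bipartition of $T$ at $z$ (with $s\in V(T_1)$, $T_2$ rooted at $z$), and $P_T=\langle v_0=s,\dots,v_{p-1}=z\rangle$ the path from $s$ to $z$ in $T$. For any failed vertex $v_f\in V(P_T)\setminus\{s\}$ and any destination $t\in V(T_2)\setminus\{z\}$, if $\mathrm{ddist}_{G-v_f}(s,t)\ge\mathrm{jdist}_{G-v_f}(s,t)$ then $\mathrm{jdist}_{G-v_f}(s,t)=\mathrm{dist}_{G-v_f}(s,z)+\mathrm{dist}_T(z,t)$.
   Context: $G-v_f$ is $G$ with $v_f$ and its incident edges removed; $\mathrm{dist}_H(u,v)$ is the weighted directed distance in $H$ ($+\infty$ if unreachable). A centroid of a tree with $N$ vertices is a vertex whose removal leaves components with at most $N/2$ vertices. The centroid bipartition at $z$ consists of two edge-disjoint connected subtrees $T_1,T_2$ with $E(T_1)\cup E(T_2)=E(T)$, $V(T_1)\cap V(T_2)=\{z\}$ and $N/3\le|V(T_1)|,|V(T_2)|\le 2N/3$, $T_1$ containing $s$. For $v_f=v_f$ of index $f\ge1$ and $t\in V(G)$, an $s$-$t$ path $R$ in $G-v_f$ is a departing path avoiding $v_f$ if (C1) the vertices of $R$ lying in $\{v_0,\dots,v_{f-1}\}$ are exactly the vertices of some prefix of $R$, and (C2) no vertex of $R$ other than $t$ lies in $\{v_{f+1},\dots,v_{p-1}\}$; it is a jumping path avoiding $v_f$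 if it satisfies (C1) and (C3) some vertex of $R$ other than $t$ lies in $\{v_{f+1},\dots,v_{p-1}\}$. $\mathrm{ddist}_{G-v_f}(s,t)$ and $\mathrm{jdist}_{G-v_f}(s,t)$ are the lengths of a shortest departing, respectively jumping, $s$-$t$ path avoiding $v_f$ ($+\infty$ if none exists). -}

module Defs where

open import Data.Nat using (ℕ; zero; suc; _+_; _*_; _≤_; _<_)
open import Data.Fin using (Fin; toℕ; fromℕ; inject₁) renaming (zero to fzero; suc to fsuc)
open import Data.Fin.Subset using (Subset; _∈_; _∉_; ∣_∣)
open import Data.List using (List; []; _∷_; length; lookup)
open import Data.List.Membership.Propositional renaming (_∈_ to _∈ₗ_; _∉_ to _∉ₗ_)
open import Data.List.Relation.Unary.All using (All)
open import Data.List.Relation.Unary.Unique.Propositional using (Unique)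
open import Data.Maybe using (Maybe; just; nothing)
open import Data.Product using (Σ; ∃; _×_; _,_)
open import Data.Sum using (_⊎_)
open import Data.Empty using (⊥)
open import Relation.Nullary using (¬_)
open import Relation.Binary.PropositionalEquality using (_≡_; _≢_)
open import Function using (_∘_)

-- Extended naturals (distances, +∞ = unreachable)

data ℕ∞ : Set where
  fin : ℕ → ℕ∞
  ∞   : ℕ∞

infixl 6 _+∞_
_+∞_ : ℕ∞ → ℕ∞ → ℕ∞
fin a +∞ fin b = fin (a + b)
fin _ +∞ ∞     = ∞
∞     +∞ _     = ∞

infix 4 _≤∞_
data _≤∞_ : ℕ∞ → ℕ∞ → Set where
  fin≤fin : ∀ {a b} → a ≤ b → fin a ≤∞ fin b
  _≤∞∞    : ∀ x → x ≤∞ ∞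

-- Weighted directed graphs on vertex set Fin n.
-- W u v ≡ just k : there is an edge u → v of weight k; nothing: no edge.

Graph : ℕ → Set
Graph n = Fin n → Fin n → Maybe ℕ

PositiveWeights : ∀ {n} → Graph n → Set
PositiveWeights {n} W = ∀ (u v : Fin n) (k : ℕ) → W u v ≡ just k → 0 < k

EdgeRel : ℕ → Set₁
EdgeRel n = Fin n → Fin n → ℕ → Set

edgesOf : ∀ {n} → Graph n → EdgeRel n
edgesOf W u v k = W u v ≡ just k

-- Walk E u v vs L : vs is the vertex sequence of a directed walk from u to v
-- using edges of E, of total weight L.
data Walk {n} (E : EdgeRel n) : Fin n → Fin n → List (Fin n) → ℕ → Set where
  here : ∀ {u} → Walk E u u (u ∷ []) 0
  step : ∀ {u v w k vs L} → E u v k → Walk E v w vs L → Walk E u w (u ∷ vs) (k + L)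

Path : ∀ {n} → EdgeRel n → Fin n → Fin n → List (Fin n) → ℕ → Set
Path E u v vs L = Walk E u v vs L × Unique vs

-- A path in G - x  (x and its incident edges removed).
PathAvoiding : ∀ {n} → EdgeRel n → Fin n → Fin n → Fin n → List (Fin n) → ℕ → Set
PathAvoiding E x u v vs L = Path E u v vs L × x ∉ₗ vs

IsMinLength : ∀ {n} → (List (Fin n) → ℕ → Set) → ℕ∞ → Set
IsMinLength Q d =
    (d ≡ ∞ × (∀ vs L → ¬ Q vs L))
  ⊎ (Σ ℕ λ k → d ≡ fin k × (∃ λ vs → Q vs k) × (∀ vs L → Q vs L → k ≤ L))

data Conn {n} (E : Fin n → Fin n → Set) : Fin n → Fin n → Set where
  refl : ∀ {u} → Conn E u u
  fwd  : ∀ {u v w} → E u v → Conn E v w → Conn E u w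
  bwd  : ∀ {u v w} → E v u → Conn E v w → Conn E u w

iter : ∀ {n} → (Fin n → Fin n) → ℕ → Fin n → Fin n
iter g zero    x = x
iter g (suc m) x = g (iter g m x)

-- Shortest-path tree of G rooted at s, given by its vertex set and
-- parent pointers. Tree edges: parent v → v for v ∈ V(T), v ≠ s.

record SPTree {n} (W : Graph n) (s : Fin n) : Set where
  field
    VT       : Subset n
    parent   : Fin n → Fin n
    s∈VT     : s ∈ VT
    parentIn : ∀ v → v ∈ VT → v ≢ s → parent v ∈ VT
    parentEdge : ∀ v → v ∈ VT → v ≢ s → ∃ λ k → W (parent v) v ≡ just k
    rooted   : ∀ v → v ∈ VT → ∃ λ m → iter parent m v ≡ s
    spanning : ∀ v → (v ∈ VT → ∃ λ vs → ∃ λ L → Walk (edgesOf W) s v vs L)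
                   × ((∃ λ vs → ∃ λ L → Walk (edgesOf W) s v vs L) → v ∈ VT)

  TEdge : Fin n → Fin n → Set
  TEdge u v = v ∈ VT × v ≢ s × parent v ≡ u

  TEdges : EdgeRel n
  TEdges u v k = TEdge u v × W u v ≡ just k

  field
    shortest : ∀ v → v ∈ VT → ∃ λ vs → ∃ λ L → Walk TEdges s v vs L
                 × (∀ ws L' → Walk (edgesOf W) s v ws L' → L ≤ L')

  N : ℕ
  N = ∣ VT ∣

  -- z is a centroid of T: every component of T - z has ≤ N/2 vertices.
  IsCentroid : Fin n → Set
  IsCentroid z = z ∈ VT ×
    (∀ u → u ∈ VT → u ≢ z → ∀ (xs : List (Fin n)) → Unique xs →
       All (Conn (λ a b → TEdge a b × a ≢ z × b ≢ z) u) xs → 2 * length xs ≤ N)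

  SubEdge : Subset n → Fin n → Fin n → Set
  SubEdge V u v = TEdge u v × u ∈ V × v ∈ V

  IsSubtree : Subset n → Set
  IsSubtree V = (∀ x → x ∈ V → x ∈ VT) × (∀ x y → x ∈ V → y ∈ V → Conn (SubEdge V) x y)

  IsCentroidBipartition : Fin n → Subset n → Subset n → Set
  IsCentroidBipartition z V1 V2 =
      IsSubtree V1 × IsSubtree V2
    × (∀ u v → TEdge u v → SubEdge V1 u v ⊎ SubEdge V2 u v)
    × (z ∈ V1 × z ∈ V2 × (∀ x → x ∈ V1 → x ∈ V2 → x ≡ z))
    × (N ≤ 3 * ∣ V1 ∣ × 3 * ∣ V1 ∣ ≤ 2 * N)
    × (N ≤ 3 * ∣ V2 ∣ × 3 * ∣ V2 ∣ ≤ 2 * N)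
    × s ∈ V1

  -- v : Fin (suc q) → Fin n is the tree path P_T = ⟨v_0 = s, …, v_q = z⟩ (p = q+1)
  IsTreePathTo : Fin n → (q : ℕ) → (Fin (suc q) → Fin n) → Set
  IsTreePathTo z q v = v fzero ≡ s × v (fromℕ q) ≡ z
    × (∀ (i : Fin q) → TEdge (v (inject₁ i)) (v (fsuc i)))

module _ {n : ℕ} {q : ℕ} (v : Fin (suc q) → Fin n) (f : Fin (suc q)) where

  Before : Fin n → Set
  Before x = ∃ λ (i : Fin (suc q)) → toℕ i < toℕ f × v i ≡ x

  After : Fin n → Set
  After x = ∃ λ (i : Fin (suc q)) → toℕ f < toℕ i × v i ≡ x

  C1 : List (Fin n) → Set
  C1 R = ∃ λ k → ∀ (j : Fin (length R)) →
           (Before (lookup R j) → toℕ j < k) × (toℕ j < k → Before (lookup R j))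

  C2 : Fin n → List (Fin n) → Set
  C2 t R = ∀ x → x ∈ₗ R → x ≢ t → ¬ After x

  C3 : Fin n → List (Fin n) → Set
  C3 t R = ∃ λ x → x ∈ₗ R × x ≢ t × After x

  IsDdist : Graph n → Fin n → Fin n → ℕ∞ → Set
  IsDdist W s t = IsMinLength (λ R L → PathAvoiding (edgesOf W) (v f) s t R L × C1 R × C2 t R)

  IsJdist : Graph n → Fin n → Fin n → ℕ∞ → Set
  IsJdist W s t = IsMinLength (λ R L → PathAvoiding (edgesOf W) (v f) s t R L × C1 R × C3 t R)

{-# OPTIONS --safe #-}
-- Let d(x) be the distance from s; it rises strictly along every tree edge, so tree walks are
-- paths and d is strictly increasing along P_T.
-- Lower bound: a jumping path R meets some v_i with i > f. The part of R up to v_i followed by the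
-- tree path v_i → z avoids v_f (all its vertices lie above v_f in d), and the rest of R is at
-- least d(t) - d(v_i) = (d(z) - d(v_i)) + dist_T(z,t); so |R| ≥ dist_{G-v_f}(s,z) + dist_T(z,t).
-- Upper bound: let Q be a shortest s-z path in G - v_f and Z the tree path z → t. Replace the part
-- of Q up to its last vertex v_j (j < f) on P_T by the tree path s → v_j, follow Q to its first
-- vertex y on Z and then Z to t. This path satisfies (C1) and is no longer than |Q| + |Z|; it is
-- either jumping or departing, and in both cases ddist ≥ jdist bounds jdist by its length.
module Submission where

open import Defs
open import Data.Nat using (ℕ; suc)
open import Data.Fin using (Fin; zero)
open import Data.Fin.Subset using (Subset; _∈_)
open import Relation.Binary.PropositionalEquality using (_≡_; _≢_)

open import Data.Nat using (_+_; _≤_; _<_; z≤n; s≤s; _<?_)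
open import Data.Nat.Properties
  using ( ≤-refl; ≤-reflexive; ≤-trans; ≤-antisym; ≤-pred
        ; <⇒≤; <⇒≱; <-irrefl; <-asym; <-≤-trans; ≤-<-trans
        ; +-assoc; +-comm; +-identityʳ; +-monoˡ-≤; +-monoʳ-≤; +-mono-≤; +-cancelˡ-≤
        ; m≤m+n; m≤n+m; m<m+n; n≤0⇒n≡0; n≢0⇒n>0; module ≤-Reasoning )
open import Data.Fin using (toℕ; fromℕ; inject₁; _≟_) renaming (suc to fsuc)
open import Data.Fin.Properties using (≤fromℕ; toℕ-inject₁; toℕ-injective; any?)
open import Data.Fin.Subset.Properties using (_∈?_)
open import Data.List using (List; []; _∷_; _++_; drop; length; lookup)
open import Data.List.Properties using (∷-injectiveʳ)
open import Data.List.Membership.Propositional using (find; lose) renaming (_∈_ to _∈ₗ_; _∉_ to _∉ₗ_)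
open import Data.List.Membership.Propositional.Properties using (∈-++⁺ˡ; ∈-++⁺ʳ; ∈-++⁻; ∈-lookup)
import Data.List.Membership.DecPropositional as DecMembership
open import Data.List.Relation.Binary.Subset.Propositional using (_⊆_)
open import Data.List.Relation.Binary.Disjoint.Propositional using (Disjoint)
open import Data.List.Relation.Unary.All as All using (All; []; _∷_)
open import Data.List.Relation.Unary.All.Properties
  using (¬Any⇒All¬; ++⁺; ++⁻ˡ; ++⁻ʳ; anti-mono; drop⁺)
open import Data.List.Relation.Unary.Any as Any using (Any; here; there)
open import Data.List.Relation.Unary.AllPairs using ([]; _∷_)
import Data.List.Relation.Unary.AllPairs as AllPairs
open import Data.List.Relation.Unary.Unique.Propositional using (Unique)
open import Data.List.Relation.Unary.Unique.Propositional.Properties using () renaming (++⁺ to Unique-++⁺)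
open import Data.Maybe.Properties using (just-injective)
open import Data.Product using (Σ; ∃; ∃₂; _×_; _,_; proj₁; proj₂)
import Data.Product as Product
open import Data.Sum using (_⊎_; inj₁; inj₂)
open import Data.Empty using (⊥-elim)
open import Function using (_∘_)
open import Relation.Nullary using (yes; no; ¬?; contradiction)
open import Relation.Nullary.Decidable using (_×-dec_)
open import Relation.Unary using (Decidable; ∁)
open import Relation.Binary.PropositionalEquality using (refl; sym; trans; cong; subst; module ≡-Reasoning)

private
  variable
    A : Set

≤∞-trans : ∀ {x y z} → x ≤∞ y → y ≤∞ z → x ≤∞ z
≤∞-trans (fin≤fin p) (fin≤fin q) = fin≤fin (≤-trans p q)
≤∞-trans _           (_ ≤∞∞)     = _ ≤∞∞

≤∞-antisym : ∀ {x y} → x ≤∞ y → y ≤∞ x → x ≡ y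
≤∞-antisym (fin≤fin p) (fin≤fin q) = cong fin (≤-antisym p q)
≤∞-antisym (_ ≤∞∞)     (_ ≤∞∞)     = refl

+∞-monoˡ-≤∞ : ∀ {x a b} → x ≤∞ fin a → x +∞ fin b ≤∞ fin (a + b)
+∞-monoˡ-≤∞ {b = b} (fin≤fin p) = fin≤fin (+-monoˡ-≤ b p)

≤∞-+∞ : ∀ {x y z} → (∀ {a b} → x ≡ fin a → y ≡ fin b → z ≤∞ fin (a + b)) →
        z ≤∞ x +∞ y
≤∞-+∞ {fin a} {fin b} bound = bound refl refl
≤∞-+∞ {fin a} {∞}     _     = _ ≤∞∞
≤∞-+∞ {∞}             _     = _ ≤∞∞

module _ {n : ℕ} {Q : List (Fin n) → ℕ → Set} where

  minLength-≤ : ∀ {d vs L} → IsMinLength Q d → Q vs L → d ≤∞ fin L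
  minLength-≤ (inj₁ (_ , none))              q = ⊥-elim (none _ _ q)
  minLength-≤ (inj₂ (_ , refl , _ , minimal)) q = fin≤fin (minimal _ _ q)

  minLength-greatest : ∀ {x d} → (∀ vs L → Q vs L → x ≤∞ fin L) → IsMinLength Q d → x ≤∞ d
  minLength-greatest _     (inj₁ (refl , _))                = _ ≤∞∞
  minLength-greatest bound (inj₂ (_ , refl , (vs , q) , _)) = bound vs _ q

  minLength-witness : ∀ {d k} → IsMinLength Q d → d ≡ fin k → ∃ λ vs → Q vs k
  minLength-witness (inj₁ (refl , _))           ()
  minLength-witness (inj₂ (_ , refl , path , _)) refl = path

Unique-++⁻ : ∀ (xs : List A) {ys} → Unique (xs ++ ys) → Unique xs × Unique ys × Disjoint xs ys
Unique-++⁻ []       ys-unique          = [] , ys-unique , λ ()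
Unique-++⁻ (x ∷ xs) (x∉xs++ys ∷ unique) with Unique-++⁻ xs unique
... | xs-unique , ys-unique , xs#ys = ++⁻ˡ xs x∉xs++ys ∷ xs-unique , ys-unique , x∷xs#ys
  where
  x∷xs#ys : Disjoint (x ∷ xs) _
  x∷xs#ys (here refl  , x∈ys) = All.lookup (++⁻ʳ xs x∉xs++ys) x∈ys refl
  x∷xs#ys (there v∈xs , v∈ys) = xs#ys (v∈xs , v∈ys)

lookup-++-prefix : ∀ {P : A → Set} (xs : List A) {ys} → All P xs → All (∁ P) ys →
  (j : Fin (length (xs ++ ys))) →
  (P (lookup (xs ++ ys) j) → toℕ j < length xs) × (toℕ j < length xs → P (lookup (xs ++ ys) j))
lookup-++-prefix []       _          ¬Pys j        =
  (λ Pj → ⊥-elim (All.lookup ¬Pys (∈-lookup j) Pj)) , λ ()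
lookup-++-prefix (x ∷ xs) (Px ∷ _)   _    zero     = (λ _ → s≤s z≤n) , λ _ → Px
lookup-++-prefix (x ∷ xs) (_ ∷ Pxs)  ¬Pys (fsuc j) =
  Product.map (s≤s ∘_) (_∘ ≤-pred) (lookup-++-prefix xs Pxs ¬Pys j)

iter-suc : ∀ {n} (g : Fin n → Fin n) m x → iter g (suc m) x ≡ iter g m (g x)
iter-suc g 0       x = refl
iter-suc g (suc m) x = cong g (iter-suc g m x)

module _ {n : ℕ} {E : EdgeRel n} where

  open DecMembership (_≟_ {n}) using () renaming (_∈?_ to _∈ₗ?_)

  private
    variable
      a a′ b c u : Fin n
      vs xs ys : List (Fin n)
      k L M N : ℕ

  walk-head : Walk E a b vs L → a ∈ₗ vs
  walk-head here       = here refl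
  walk-head (step _ _) = here refl

  walk-last : Walk E a b vs L → b ∈ₗ vs
  walk-last here       = here refl
  walk-last (step _ w) = there (walk-last w)

  Walk-map : ∀ {E′ : EdgeRel n} → (∀ {u w k} → E u w k → E′ u w k) →
             Walk E a b vs L → Walk E′ a b vs L
  Walk-map g here       = here
  Walk-map g (step e w) = step (g e) (Walk-map g w)

  infixr 5 _++ᵂ_
  _++ᵂ_ : Walk E a b xs M → Walk E b c ys N → Walk E a c (xs ++ drop 1 ys) (M + N)
  here                     ++ᵂ here       = here
  here                     ++ᵂ step e w   = step e w
  step {k = k} {L = L} e w ++ᵂ w′         =
    subst (Walk E _ _ _) (sym (+-assoc k L _)) (step e (w ++ᵂ w′))

  walk-lastEdge : E a a′ k → Walk E a′ b vs L →
    ∃ λ u → ∃ λ k′ → ∃₂ λ ps L′ → Walk E a u ps L′ × E u b k′ × L′ + k′ ≡ k + L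
  walk-lastEdge {k = k} e here = _ , k , _ , 0 , here , e , +-comm 0 k
  walk-lastEdge {k = k} e (step e′ w) with walk-lastEdge e′ w
  ... | u , k′ , _ , L′ , w′ , e″ , L′+k′≡ =
    u , k′ , _ , k + L′ , step e w′ , e″ , trans (+-assoc k L′ k′) (cong (k +_) L′+k′≡)

  record Split (a b u : Fin n) (vs : List (Fin n)) (L : ℕ) : Set where
    constructor split
    field
      ps qs : List (Fin n)
      L₁ L₂ : ℕ
      pre   : Walk E a u (a ∷ ps) L₁
      suf   : Walk E u b (u ∷ qs) L₂
      vs≡   : vs ≡ a ∷ ps ++ qs
      L≡    : L₁ + L₂ ≡ L

    pre⊆ : a ∷ ps ⊆ vs
    pre⊆ x∈ = subst (_ ∈ₗ_) (sym vs≡) (∈-++⁺ˡ x∈)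

    suf⊆ : qs ⊆ vs
    suf⊆ x∈ = subst (_ ∈ₗ_) (sym vs≡) (∈-++⁺ʳ (a ∷ ps) x∈)

    L₁≤L : L₁ ≤ L
    L₁≤L = subst (L₁ ≤_) L≡ (m≤m+n L₁ L₂)

    L₂≤L : L₂ ≤ L
    L₂≤L = subst (L₂ ≤_) L≡ (m≤n+m L₂ L₁)

    suf-unique : Unique vs → Unique (u ∷ qs)
    suf-unique vs-unique with Unique-++⁻ (a ∷ ps) (subst Unique vs≡ vs-unique)
    ... | _ , qs-unique , pre#qs =
      All.tabulate (λ x∈qs u≡x → pre#qs (walk-last pre , subst (_∈ₗ qs) (sym u≡x) x∈qs)) ∷ qs-unique

  split-cons : E a a′ k → Split a′ b u vs L → Split a b u (a ∷ vs) (k + L)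
  split-cons {a = a} {k = k} e sp =
    split (_ ∷ ps) qs (k + L₁) L₂ (step e pre) suf
          (cong (a ∷_) vs≡) (trans (+-assoc k L₁ L₂) (cong (k +_) L≡))
    where open Split sp

  splitAt : Walk E a b vs L → u ∈ₗ vs → Split a b u vs L
  splitAt here       (here refl) = split [] [] 0 0 here here refl refl
  splitAt (step e w) (here refl) = split [] _ 0 _ here (step e w) refl refl
  splitAt (step e w) (there u∈)  = split-cons e (splitAt w u∈)

  module _ {P : Fin n → Set} (P? : Decidable P) where

    splitFirst : Walk E a b vs L → Any P vs →
      ∃ λ u → P u × Σ (Split a b u vs L) λ sp → All (λ x → P x → x ≡ u) (a ∷ Split.ps sp)
    splitFirst here (here Pa) = _ , Pa , split [] [] 0 0 here here refl refl , (λ _ → refl) ∷ []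
    splitFirst {a = a} (step e w) P-somewhere with P? a
    ... | yes Pa  = a , Pa , split [] _ 0 _ here (step e w) refl refl , (λ _ → refl) ∷ []
    ... | no  ¬Pa with splitFirst w (Any.tail ¬Pa P-somewhere)
    ...   | u , Pu , sp , first = u , Pu , split-cons e sp , (λ Pa → contradiction Pa ¬Pa) ∷ first

    splitLast : Walk E a b vs L → Any P vs →
      ∃ λ u → P u × Σ (Split a b u vs L) λ sp → All (∁ P) (Split.qs sp)
    splitLast here (here Pa) = _ , Pa , split [] [] 0 0 here here refl refl , []
    splitLast (step {vs = vs} e w) P-somewhere with Any.any? P? vs
    ... | yes P-later with splitLast w P-later
    ...   | u , Pu , sp , last = u , Pu , split-cons e sp , last
    splitLast (step {vs = vs} e w) P-somewhere | no ¬P-later =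
      _ , Any.head ¬P-later P-somewhere , split [] vs 0 _ here (step e w) refl refl , ¬Any⇒All¬ vs ¬P-later

  walk⇒path : Walk E a b vs L → ∃₂ λ ws L′ → Path E a b ws L′ × L′ ≤ L × ws ⊆ vs
  walk⇒path here = _ , _ , (here , [] ∷ []) , ≤-refl , λ x∈ → x∈
  walk⇒path {a = a} (step {k = k} {L = L} e w) with walk⇒path w
  ... | ws , L′ , (w′ , ws-unique) , L′≤L , ws⊆ with a ∈ₗ? ws
  ...   | no a∉ws =
    a ∷ ws , k + L′ , (step e w′ , ¬Any⇒All¬ ws a∉ws ∷ ws-unique) , +-monoʳ-≤ k L′≤L ,
    λ { (here x≡a) → here x≡a ; (there x∈ws) → there (ws⊆ x∈ws) }
  ...   | yes a∈ws =
    a ∷ qs , L₂ , (suf , suf-unique ws-unique) , ≤-trans L₂≤L (≤-trans L′≤L (m≤n+m L k)) ,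
    λ { (here x≡a) → here x≡a ; (there x∈qs) → there (ws⊆ (suf⊆ x∈qs)) }
    where open Split (splitAt w′ a∈ws)

  chainWalk : ∀ {q} {v : Fin (suc q) → Fin n} → (∀ i → ∃ (E (v (inject₁ i)) (v (fsuc i)))) →
    ∀ {i j} → toℕ i ≤ toℕ j →
    ∃₂ λ vs L → Walk E (v i) (v j) vs L × All (λ x → ∃ λ k → toℕ k ≤ toℕ j × v k ≡ x) vs
  chainWalk edges {zero} {zero} _ = _ , _ , here , (zero , z≤n , refl) ∷ []
  chainWalk {q = suc q} {v = v} edges {zero} {fsuc j} _
    with chainWalk {v = v ∘ fsuc} (edges ∘ fsuc) {zero} {j} z≤n
  ... | _ , _ , w , on-chain =
    _ , _ , step (proj₂ (edges zero)) w ,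
    (zero , z≤n , refl) ∷ All.map (λ { (k , k≤j , refl) → fsuc k , s≤s k≤j , refl }) on-chain
  chainWalk {q = suc q} {v = v} edges {fsuc i} {fsuc j} (s≤s i≤j)
    with chainWalk {v = v ∘ fsuc} (edges ∘ fsuc) i≤j
  ... | _ , _ , w , on-chain =
    _ , _ , w , All.map (λ { (k , k≤j , refl) → fsuc k , s≤s k≤j , refl }) on-chain

module Potential {n : ℕ} {E : EdgeRel n} (φ : Fin n → ℕ)
  (tight : ∀ {u w k} → E u w k → φ w ≡ φ u + k) (positive : ∀ {u w k} → E u w k → 0 < k) where

  private
    variable
      a b u w : Fin n
      vs : List (Fin n)
      k L : ℕ

  edge-increasing : E u w k → φ u < φ w
  edge-increasing {u} e = subst (φ u <_) (sym (tight e)) (m<m+n (φ u) (positive e))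

  walk-tight : Walk E a b vs L → φ b ≡ φ a + L
  walk-tight {a} here = sym (+-identityʳ (φ a))
  walk-tight {a} {b} (step {v = a′} {k = k} {L = L} e w) = begin
    φ b           ≡⟨ walk-tight w ⟩
    φ a′ + L      ≡⟨ cong (_+ L) (tight e) ⟩
    φ a + k + L   ≡⟨ +-assoc (φ a) k L ⟩
    φ a + (k + L) ∎
    where open ≡-Reasoning

  walk-≥-start : Walk E a b vs L → All (λ x → φ a ≤ φ x) vs
  walk-≥-start here       = ≤-refl ∷ []
  walk-≥-start (step e w) = ≤-refl ∷ All.map (≤-trans (<⇒≤ (edge-increasing e))) (walk-≥-start w)

  walk-tail->-start : Walk E a b (a ∷ vs) L → All (λ x → φ a < φ x) vs
  walk-tail->-start here       = []
  walk-tail->-start (step e w) = All.map (<-≤-trans (edge-increasing e)) (walk-≥-start w)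

  walk-unique : Walk E a b vs L → Unique vs
  walk-unique here       = [] ∷ []
  walk-unique (step e w) =
    All.map (λ a<x a≡x → <-irrefl (cong φ a≡x) a<x) (walk-tail->-start (step e w)) ∷ walk-unique w

  module _ {q} {v : Fin (suc q) → Fin n} (edges : ∀ i → ∃ (E (v (inject₁ i)) (v (fsuc i)))) where

    chain-≤ : ∀ {i j} → toℕ i ≤ toℕ j → φ (v i) ≤ φ (v j)
    chain-≤ i≤j with chainWalk edges i≤j
    ... | _ , L , w , _ = subst (φ (v _) ≤_) (sym (walk-tight w)) (m≤m+n _ L)

    chain-< : ∀ {i j} → toℕ i < toℕ j → φ (v i) < φ (v j)
    chain-< {i} {fsuc j} (s≤s i≤j) =
      ≤-<-trans (chain-≤ (subst (toℕ i ≤_) (sym (toℕ-inject₁ j)) i≤j))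
                (edge-increasing (proj₂ (edges j)))

module _ {n q : ℕ} (v : Fin (suc q) → Fin n) (f : Fin (suc q)) where

  Before? : Decidable (Before v f)
  Before? x = any? λ i → (toℕ i <? toℕ f) ×-dec (v i ≟ x)

  After? : Decidable (After v f)
  After? x = any? λ i → (toℕ f <? toℕ i) ×-dec (v i ≟ x)

  jumping-or-departing : ∀ t R → C3 v f t R ⊎ C2 v f t R
  jumping-or-departing t R with Any.any? (λ x → ¬? (x ≟ t) ×-dec After? x) R
  ... | yes jumps  = inj₁ (find jumps)
  ... | no ¬jumps = inj₂ λ x x∈R x≢t after → ¬jumps (lose x∈R (x≢t , after))

  jdist-≤-C1-path : ∀ {W s t dd jd R L} → IsDdist v f W s t dd → IsJdist v f W s t jd → jd ≤∞ dd →
    PathAvoiding (edgesOf W) (v f) s t R L → C1 v f R → jd ≤∞ fin L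
  jdist-≤-C1-path {t = t} {R = R} isDd isJd jd≤dd path c1 with jumping-or-departing t R
  ... | inj₁ c3 = minLength-≤ isJd (path , c1 , c3)
  ... | inj₂ c2 = ≤∞-trans jd≤dd (minLength-≤ isDd (path , c1 , c2))

module ShortestPathTree {n} {W : Graph n} (pos : PositiveWeights W) {s : Fin n} (T : SPTree W s) where
  open SPTree T
  open DecMembership (_≟_ {n}) using () renaming (_∈?_ to _∈ₗ?_)

  private
    G : EdgeRel n
    G = edgesOf W

    variable
      u w x y z t : Fin n
      vs : List (Fin n)
      k L : ℕ

  -- The junk value 0 off V(T) is never used: every walk from s stays in V(T).
  dist : Fin n → ℕ
  dist x with x ∈? VT
  ... | yes x∈VT = proj₁ (proj₂ (shortest x x∈VT))
  ... | no  _    = 0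

  treeWalkFromRoot : x ∈ VT → ∃ λ vs → Walk TEdges s x vs (dist x)
  treeWalkFromRoot {x} x∈VT with x ∈? VT
  ... | yes x∈VT′ = let vs , _ , w , _ = shortest x x∈VT′ in vs , w
  ... | no  x∉VT  = contradiction x∈VT x∉VT

  dist-≤ : Walk G s x vs L → dist x ≤ L
  dist-≤ {x} {vs} {L} w with x ∈? VT
  ... | yes x∈VT = proj₂ (proj₂ (proj₂ (shortest x x∈VT))) vs L w
  ... | no  x∉VT = contradiction (proj₂ (spanning x) (vs , L , w)) x∉VT

  dist-s : dist s ≡ 0
  dist-s = n≤0⇒n≡0 (dist-≤ here)

  treeWalk⇒walk : Walk TEdges x y vs L → Walk G x y vs L
  treeWalk⇒walk = Walk-map proj₂

  dist-triangle : x ∈ VT → Walk G x y vs L → dist y ≤ dist x + L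
  dist-triangle x∈VT w = let _ , to-x = treeWalkFromRoot x∈VT in dist-≤ (treeWalk⇒walk to-x ++ᵂ w)

  TEdge⇒TEdges : TEdge u w → ∃ (TEdges u w)
  TEdge⇒TEdges {w = w} u→w@(w∈VT , w≢s , refl) = let k , Wk = parentEdge w w∈VT w≢s in k , u→w , Wk

  TEdge-source∈VT : TEdge u w → u ∈ VT
  TEdge-source∈VT (w∈VT , w≢s , refl) = parentIn _ w∈VT w≢s

  dist-source+k≤treeWalk : TEdges u w k → Walk TEdges s w vs L → dist u + k ≤ L
  dist-source+k≤treeWalk ((_ , w≢s , _) , _) here = contradiction refl w≢s
  dist-source+k≤treeWalk ((_ , _ , refl) , Wk) (step e w) with walk-lastEdge e w
  ... | _ , _ , _ , _ , to-u , ((_ , _ , refl) , Wk′) , L′+k′≡L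
    rewrite just-injective (trans (sym Wk) Wk′) =
    ≤-trans (+-monoˡ-≤ _ (dist-≤ (treeWalk⇒walk to-u))) (≤-reflexive L′+k′≡L)

  TEdges-tight : TEdges u w k → dist w ≡ dist u + k
  TEdges-tight {u} {w} {k} e@((w∈VT , _) , Wk) = ≤-antisym
    (subst (dist w ≤_) (cong (dist u +_) (+-identityʳ k))
           (dist-triangle (TEdge-source∈VT (proj₁ e)) (step Wk here)))
    (dist-source+k≤treeWalk e (proj₂ (treeWalkFromRoot w∈VT)))

  open Potential {E = TEdges} dist TEdges-tight (λ (_ , Wk) → pos _ _ _ Wk)

  dist≡treeWalk-length : Walk TEdges s x vs L → dist x ≡ L
  dist≡treeWalk-length w = trans (walk-tight w) (cong (_+ _) dist-s)

  walkFromCentroid : ∀ {z V1 V2} → IsCentroidBipartition z V1 V2 → x ∈ V2 → ∃₂ (Walk TEdges z x)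
  walkFromCentroid {x} {z} {V1} {V2} (_ , (V2⊆VT , _) , cover , (_ , _ , V1∩V2⊆z) , _ , _ , s∈V1) x∈V2 =
    let m , reaches-s = rooted x (V2⊆VT x x∈V2) in descend m x∈V2 reaches-s
    where
    ≢s : ∀ {y} → y ∈ V2 → y ≢ z → y ≢ s
    ≢s y∈V2 y≢z refl = y≢z (V1∩V2⊆z s s∈V1 y∈V2)

    descend : ∀ m {y} → y ∈ V2 → iter parent m y ≡ s → ∃₂ (Walk TEdges z y)
    descend m       {y} y∈V2 reaches-s with y ≟ z
    descend m           y∈V2 reaches-s | yes refl = _ , _ , here
    descend 0           y∈V2 reaches-s | no  y≢z  = contradiction reaches-s (≢s y∈V2 y≢z)
    descend (suc m) {y} y∈V2 reaches-s | no  y≢z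
      with cover (parent y) y (V2⊆VT y y∈V2 , ≢s y∈V2 y≢z , refl)
    ... | inj₁ (_ , _ , y∈V1)       = contradiction (V1∩V2⊆z y y∈V1 y∈V2) y≢z
    ... | inj₂ (p→y , parent∈V2 , _) =
      let _ , _ , to-parent = descend m parent∈V2 (trans (sym (iter-suc parent m y)) reaches-s)
      in _ , _ , to-parent ++ᵂ step (proj₂ (TEdge⇒TEdges p→y)) here

  dist-from-centroid : ∀ {z V1 V2 d} → IsCentroidBipartition z V1 V2 → x ∈ V2 →
    IsMinLength (Path TEdges z x) d → ∃ λ k → d ≡ fin k × dist x ≡ dist z + k
  dist-from-centroid bip x∈V2 (inj₁ (_ , no-path)) =
    let _ , _ , w = walkFromCentroid bip x∈V2 in ⊥-elim (no-path _ _ (w , walk-unique w))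
  dist-from-centroid bip x∈V2 (inj₂ (k , d≡k , (_ , w , _) , _)) = k , d≡k , walk-tight w

  module _ {z q} {v : Fin (suc q) → Fin n} (tp : IsTreePathTo z q v) (f : Fin (suc q)) where

    private
      v-edges : ∀ i → ∃ (TEdges (v (inject₁ i)) (v (fsuc i)))
      v-edges i = TEdge⇒TEdges (proj₂ (proj₂ tp) i)

      v-last≡z : v (fromℕ q) ≡ z
      v-last≡z = proj₁ (proj₂ tp)

      dist-v-≤ : ∀ {i j} → toℕ i ≤ toℕ j → dist (v i) ≤ dist (v j)
      dist-v-≤ = chain-≤ {v = v} v-edges

      dist-v-< : ∀ {i j} → toℕ i < toℕ j → dist (v i) < dist (v j)
      dist-v-< = chain-< {v = v} v-edges

    v∈VT : ∀ i → v i ∈ VT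
    v∈VT zero     = subst (_∈ VT) (sym (proj₁ tp)) s∈VT
    v∈VT (fsuc i) = proj₁ (proj₂ (proj₂ tp) i)

    dist-v-f≤dist-z : dist (v f) ≤ dist z
    dist-v-f≤dist-z = subst (λ y → dist (v f) ≤ dist y) v-last≡z (dist-v-≤ (≤fromℕ f))

    Before⇒dist<z : Before v f x → dist x < dist z
    Before⇒dist<z (i , i<f , refl) =
      subst (λ y → dist (v i) < dist y) v-last≡z (dist-v-< (<-≤-trans i<f (≤fromℕ f)))

    Before⇒≢v-f : Before v f x → x ≢ v f
    Before⇒≢v-f (i , i<f , refl) v-i≡v-f = <-irrefl (cong dist v-i≡v-f) (dist-v-< i<f)

    treePrefix : ∀ {j} → toℕ j < toℕ f →
      ∃₂ λ tl L → Walk TEdges s (v j) tl L × All (Before v f) tl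
    treePrefix {j} j<f with chainWalk {v = v} v-edges {zero} {j} z≤n
    ... | tl , L , w , on-prefix =
      tl , L , subst (λ a → Walk TEdges a (v j) tl L) (proj₁ tp) w ,
      All.map (λ (k , k≤j , v-k≡x) → k , ≤-<-trans k≤j j<f , v-k≡x) on-prefix

    treeSuffix : ∀ {i} → toℕ f < toℕ i →
      ∃₂ λ tl L → Walk TEdges (v i) z tl L × All (λ y → dist (v f) < dist y) tl
    treeSuffix {i} f<i with chainWalk {v = v} v-edges (≤fromℕ i)
    ... | tl , L , w , _ =
      tl , L , subst (λ b → Walk TEdges (v i) b tl L) v-last≡z w ,
      All.map (<-≤-trans (dist-v-< f<i)) (walk-≥-start w)

    jumping-lower-bound : ∀ {V1 V2 dsz dzt R L} → IsCentroidBipartition z V1 V2 → t ∈ V2 →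
      IsMinLength (PathAvoiding G (v f) s z) dsz → IsMinLength (Path TEdges z t) dzt →
      PathAvoiding G (v f) s t R L × C1 v f R × C3 v f t R → dsz +∞ dzt ≤∞ fin L
    jumping-lower-bound {t = t} {dsz = dsz} {L = L} bip t∈V2 isDsz isDzt
      (((R-walk , _) , v-f∉R) , _ , _ , x∈R , _ , i , f<i , refl)
      with dist-from-centroid bip t∈V2 isDzt | treeSuffix f<i
    ... | k , refl , t≡z+k | tl , Lt , to-z , above-v-f =
      ≤∞-trans (+∞-monoˡ-≤∞ dsz≤detour) (fin≤fin detour+k≤L)
      where
      open Split (splitAt R-walk x∈R)

      detour-avoids : v f ∉ₗ s ∷ ps ++ drop 1 tl
      detour-avoids v-f∈ with ∈-++⁻ (s ∷ ps) v-f∈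
      ... | inj₁ in-pre  = v-f∉R (pre⊆ in-pre)
      ... | inj₂ in-tree = <-irrefl refl (All.lookup (drop⁺ 1 above-v-f) in-tree)

      dsz≤detour : dsz ≤∞ fin (L₁ + Lt)
      dsz≤detour with walk⇒path (pre ++ᵂ treeWalk⇒walk to-z)
      ... | _ , _ , path , L′≤ , ⊆detour =
        ≤∞-trans (minLength-≤ isDsz (path , detour-avoids ∘ ⊆detour)) (fin≤fin L′≤)

      via-v-i : dist (v i) + (Lt + k) ≤ dist (v i) + L₂
      via-v-i = begin
        dist (v i) + (Lt + k) ≡⟨ +-assoc (dist (v i)) Lt k ⟨
        dist (v i) + Lt + k   ≡⟨ cong (_+ k) (walk-tight to-z) ⟨
        dist z + k            ≡⟨ t≡z+k ⟨
        dist t                ≤⟨ dist-triangle (v∈VT i) suf ⟩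
        dist (v i) + L₂       ∎
        where open ≤-Reasoning

      detour+k≤L : L₁ + Lt + k ≤ L
      detour+k≤L = begin
        L₁ + Lt + k   ≡⟨ +-assoc L₁ Lt k ⟩
        L₁ + (Lt + k) ≤⟨ +-monoʳ-≤ L₁ (+-cancelˡ-≤ (dist (v i)) _ _ via-v-i) ⟩
        L₁ + L₂       ≡⟨ L≡ ⟩
        L             ∎
        where open ≤-Reasoning

    C1-path-through : ∀ {u y tl ps zs L₀ L₁ L₂} →
      Walk TEdges s u tl L₀ → All (Before v f) tl →
      Walk G u y (u ∷ ps) L₁ → Unique ps → All (∁ (Before v f)) ps → v f ∉ₗ ps →
      Walk TEdges y t (y ∷ zs) L₂ → dist z ≤ dist y → Disjoint ps zs →
      PathAvoiding G (v f) s t (tl ++ ps ++ zs) (L₀ + (L₁ + L₂)) × C1 v f (tl ++ ps ++ zs)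
    C1-path-through {tl = tl} {ps} {zs} to-u tl-before middle ps-unique ps-after v-f∉ps from-y z≤y ps#zs =
      ((treeWalk⇒walk to-u ++ᵂ middle ++ᵂ treeWalk⇒walk from-y , unique) , avoids) ,
      length tl , lookup-++-prefix tl tl-before rest-after
      where
      zs-above-z : All (λ x → dist z < dist x) zs
      zs-above-z = All.map (≤-<-trans z≤y) (walk-tail->-start from-y)

      rest-after : All (∁ (Before v f)) (ps ++ zs)
      rest-after = ++⁺ ps-after (All.map (λ z<x before → <-asym z<x (Before⇒dist<z before)) zs-above-z)

      tl#rest : Disjoint tl (ps ++ zs)
      tl#rest (x∈tl , x∈rest) = All.lookup rest-after x∈rest (All.lookup tl-before x∈tl)

      unique : Unique (tl ++ ps ++ zs)
      unique = Unique-++⁺ (walk-unique to-u)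
                 (Unique-++⁺ ps-unique (AllPairs.tail (walk-unique from-y)) ps#zs) tl#rest

      avoids : v f ∉ₗ tl ++ ps ++ zs
      avoids v-f∈ with ∈-++⁻ tl v-f∈
      ... | inj₁ in-tl = Before⇒≢v-f (All.lookup tl-before in-tl) refl
      ... | inj₂ in-rest with ∈-++⁻ ps in-rest
      ...   | inj₁ in-ps = v-f∉ps in-ps
      ...   | inj₂ in-zs = <⇒≱ (All.lookup zs-above-z in-zs) dist-v-f≤dist-z

    shortcut-at-first-meeting : ∀ {u ss zl tl L₀ L₁ L₂} →
      Walk TEdges s u tl L₀ → All (Before v f) tl →
      Walk G u z (u ∷ ss) L₁ → Unique ss → All (∁ (Before v f)) ss → v f ∉ₗ ss →
      Walk TEdges z t zl L₂ →
      ∃₂ λ R L → (PathAvoiding G (v f) s t R L × C1 v f R) × L ≤ L₀ + (L₁ + L₂)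
    shortcut-at-first-meeting {t = t} {ss = ss} {zl} {L₀ = L₀}
                              to-u tl-before to-z ss-unique ss-after v-f∉ss Z
      with splitFirst (_∈ₗ? zl) to-z (lose (walk-last to-z) (walk-head Z))
    ... | y , y∈Z , to-y , first-meeting =
      _ , _ ,
      C1-path-through to-u tl-before (Split.pre to-y) ps-unique (anti-mono ps⊆ss ss-after) (v-f∉ss ∘ ps⊆ss)
                      (Split.suf from-y) (All.lookup (walk-≥-start Z) y∈Z) ps#zs ,
      +-monoʳ-≤ L₀ (+-mono-≤ (Split.L₁≤L to-y) (Split.L₂≤L from-y))
      where
      from-y : Split z t y zl _
      from-y = splitAt Z y∈Z

      ss≡ : ss ≡ Split.ps to-y ++ Split.qs to-y
      ss≡ = ∷-injectiveʳ (Split.vs≡ to-y)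

      ps⊆ss : Split.ps to-y ⊆ ss
      ps⊆ss x∈ps = subst (_ ∈ₗ_) (sym ss≡) (∈-++⁺ˡ x∈ps)

      ps-unique : Unique (Split.ps to-y)
      ps-unique = proj₁ (Unique-++⁻ (Split.ps to-y) (subst Unique ss≡ ss-unique))

      ps#zs : Disjoint (Split.ps to-y) (Split.qs from-y)
      ps#zs (x∈ps , x∈zs) with All.lookup first-meeting (there x∈ps) (Split.suf⊆ from-y x∈zs)
      ... | refl = <-irrefl refl (All.lookup (walk-tail->-start (Split.suf from-y)) x∈zs)

    shortcut-via-z : ∀ {Q zl m k} → Before v f s →
      PathAvoiding G (v f) s z Q m → Path TEdges z t zl k →
      ∃₂ λ R L → (PathAvoiding G (v f) s t R L × C1 v f R) × L ≤ m + k
    shortcut-via-z {m = m} {k} s-before ((Q-walk , Q-unique) , v-f∉Q) (Z , _)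
      with splitLast (Before? v f) Q-walk (lose (walk-head Q-walk) s-before)
    ... | _ , (j , j<f , refl) , at-v-j , ss-after with treePrefix j<f
    ... | _ , L₀ , to-v-j , tl-before
      with shortcut-at-first-meeting to-v-j tl-before (Split.suf at-v-j)
             (AllPairs.tail (Split.suf-unique at-v-j Q-unique)) ss-after (v-f∉Q ∘ Split.suf⊆ at-v-j) Z
    ... | R , L , R-path , L≤ = R , L , R-path , ≤-trans L≤ via-v-j
      where
      open Split at-v-j

      via-v-j : L₀ + (L₂ + k) ≤ m + k
      via-v-j = begin
        L₀ + (L₂ + k) ≤⟨ +-monoˡ-≤ (L₂ + k) L₀≤L₁ ⟩
        L₁ + (L₂ + k) ≡⟨ +-assoc L₁ L₂ k ⟨
        L₁ + L₂ + k   ≡⟨ cong (_+ k) L≡ ⟩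
        m + k         ∎
        where
        open ≤-Reasoning
        L₀≤L₁ : L₀ ≤ L₁
        L₀≤L₁ = subst (_≤ L₁) (dist≡treeWalk-length to-v-j) (dist-≤ pre)

lemma11 : ∀ {n} (W : Graph n) → PositiveWeights W → (s : Fin n) → (T : SPTree W s)
    → (z : Fin n) → SPTree.IsCentroid T z
    → (V1 V2 : Subset n) → SPTree.IsCentroidBipartition T z V1 V2
    → (q : ℕ) (v : Fin (suc q) → Fin n) → SPTree.IsTreePathTo T z q v
    → (f : Fin (suc q)) → f ≢ zero
    → (t : Fin n) → t ∈ V2 → t ≢ z
    → (dd jd dsz dzt : ℕ∞)
    → IsDdist v f W s t dd
    → IsJdist v f W s t jd
    → IsMinLength (PathAvoiding (edgesOf W) (v f) s z) dsz
    → IsMinLength (Path (SPTree.TEdges T) z t) dzt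
    → jd ≤∞ dd
    → jd ≡ dsz +∞ dzt
lemma11 W pos s T z _ V1 V2 bip q v tp f f≢0 t t∈V2 _ dd jd dsz dzt isDd isJd isDsz isDzt jd≤dd =
  ≤∞-antisym jd≤dsz+dzt dsz+dzt≤jd
  where
  open ShortestPathTree pos T

  s-before : Before v f s
  s-before = zero , n≢0⇒n>0 (f≢0 ∘ toℕ-injective) , proj₁ tp

  jd≤dsz+dzt : jd ≤∞ dsz +∞ dzt
  jd≤dsz+dzt = ≤∞-+∞ λ dsz≡m dzt≡k →
    let _ , shortest-avoiding = minLength-witness isDsz dsz≡m
        _ , tree-path         = minLength-witness isDzt dzt≡k
        _ , _ , (R-path , R-C1) , L≤m+k = shortcut-via-z tp f s-before shortest-avoiding tree-path
    in ≤∞-trans (jdist-≤-C1-path v f isDd isJd jd≤dd R-path R-C1) (fin≤fin L≤m+k)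

  dsz+dzt≤jd : dsz +∞ dzt ≤∞ jd
  dsz+dzt≤jd = minLength-greatest (λ _ _ → jumping-lower-bound tp f bip t∈V2 isDsz isDzt) isJd
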